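{- Let $(b_{n,m})_{n,m\geq 1}$ be defined by $b_{1,1}=1$, $b_{n,m}=0$ for $n<m$, and \[ b_{n,m}=(2n+m-2)\sum_{k=1}^{m}b_{n-1,k}\qquad(n\geq 2,\ 1\leq m\leq n). \] Then for every $n\geq 1$, $a_n=\sum_{m\geq 1}b_{n,m}$.
   Context: For $n\geq1$, $\mathcal{A}_n$ is the set of words over the alphabet $\{\omega_1,\ldots,\omega_n\}$ in which every letter occurs exactly $3$ times and such that in every prefix, for every $i$, either $\omega_i$ does not occur in the prefix or the number of occurrences of $\omega_i$ in the prefix is at least the number of occurrences of $\omega_j$ in the prefix for every $j>i$; $a_n=|\mathcal{A}_n|$. -}

module Defs where

open import Data.Nat using (ℕ; zero; suc; _+_; _*_; _∸_; _≤_; _≤?_)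
open import Data.Fin using (Fin)
import Data.Fin as F
open import Data.List using (List; []; _∷_; _++_; length)
open import Data.Bool using (if_then_else_)
open import Data.Sum using (_⊎_)
open import Relation.Binary.PropositionalEquality using (_≡_)
open import Relation.Nullary.Decidable using (⌊_⌋)

count : {n : ℕ} → Fin n → List (Fin n) → ℕ
count i [] = 0
count i (x ∷ w) = if ⌊ i F.≟ x ⌋ then suc (count i w) else count i w

PrefixOK : {n : ℕ} → List (Fin n) → Set
PrefixOK {n} p = (i : Fin n) →
  count i p ≡ 0 ⊎ ((j : Fin n) → i F.< j → count j p ≤ count i p)

-- membership in 𝒜_n (letter ω_{i+1} is represented by i : Fin n)
InA : (n : ℕ) → List (Fin n) → Set
InA n w = ((i : Fin n) → count i w ≡ 3)
        × ((p s : List (Fin n)) → p ++ s ≡ w → PrefixOK p)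
  where open import Data.Product using (_×_)

sum1 : ℕ → (ℕ → ℕ) → ℕ
sum1 zero f = 0
sum1 (suc m) f = sum1 m f + f (suc m)

-- b n m for n, m ≥ 1 (values at index 0 are irrelevant, set to 0)
b : ℕ → ℕ → ℕ
b zero m = 0
b (suc zero) m = if ⌊ m Data.Nat.≟ 1 ⌋ then 1 else 0
b (suc (suc n)) zero = 0
b (suc (suc n)) (suc m) =
  if ⌊ suc m ≤? suc (suc n) ⌋
  then (2 * suc (suc n) + suc m ∸ 2) * sum1 (suc m) (b (suc n))
  else 0

module Submission where

-- Let ⊤ be the new, largest letter of 𝒜_{N+1}.  Erasing its three copies from
-- a valid word leaves a valid word u = A B C of 𝒜_N, and the word is A ⊤ B ⊤ C ⊤:
-- nothing may follow the third ⊤, the first ⊤ is unconstrained, and the second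
-- must stand where every letter seen so far occurs at least twice
-- (decompose, withTops-valid, withTops-erasure).  With the threshold r(u) of u,
-- the least r beyond which all prefixes have this property (Threshold), the
-- word A ⊤ B ⊤ C ⊤ is valid iff |A B| ≥ r(u), and its threshold is |A B| + 2.
-- Let G N k list the words of threshold (k - 1) + 2N.  Then G (N+1) (m+1) is
-- obtained from G N 1, …, G N (m+1) by taking |A B| = m + 2N and one of the
-- m + 2N + 1 splittings of that prefix: the recursion of b.  By induction on
-- N (Invariant), G N 1 ++ … ++ G N N enumerates 𝒜_N without repetition.

open import Defs
open import Data.Nat using (ℕ; zero; suc; _+_; _*_; _∸_; _≤_; z≤n; s≤s; _≤?_)
import Data.Nat as ℕ
open import Data.Nat.Properties
open import Data.Nat.Solver using (module +-*-Solver)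
open import Data.Fin as F using (Fin; inject₁; fromℕ)
import Data.Fin.Properties as FP
open import Data.List using (List; []; _∷_; _++_; map; length; take; drop; concatMap)
open import Data.List.Properties using (++-assoc; ++-identityʳ; length-++; length-map; map-++; take++drop≡id; length-take; ∷-injective; length-++-≤ˡ)
open import Data.List.Membership.Propositional using (_∈_; find; lose)
open import Data.List.Membership.Propositional.Properties using (∈-map⁺; ∈-map⁻; ∈-++⁺ˡ; ∈-++⁺ʳ; ∈-++⁻; ∈-concatMap⁺; ∈-concatMap⁻)
open import Data.List.Relation.Unary.Any using (here; there)
import Data.List.Relation.Unary.All as All
open All using (All; [])
import Data.List.Relation.Unary.All.Properties as AllP
open import Data.List.Relation.Unary.AllPairs using ([]; _∷_)
open import Data.List.Relation.Unary.Unique.Propositional using (Unique)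
import Data.List.Relation.Unary.Unique.Propositional.Properties as UniqueP
open import Data.Bool using (if_then_else_)
open import Data.Product using (Σ; _×_; _,_; proj₁; proj₂)
open import Data.Sum using (_⊎_; inj₁; inj₂)
open import Data.Empty using (⊥; ⊥-elim)
open import Relation.Binary.PropositionalEquality
open import Relation.Nullary using (¬_; yes; no)
open import Relation.Nullary.Decidable using (⌊_⌋)
open import Function using (_∘_)
open import Function.Bundles using (_⇔_; mk⇔)

count-++ : ∀ {n} (i : Fin n) xs ys → count i (xs ++ ys) ≡ count i xs + count i ys
count-++ i [] ys = refl
count-++ i (x ∷ xs) ys with i F.≟ x
... | yes _ = cong suc (count-++ i xs ys)
... | no _ = count-++ i xs ys

count-here : ∀ {n} (i : Fin n) w → count i (i ∷ w) ≡ suc (count i w)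
count-here i w with i F.≟ i
... | yes _ = refl
... | no i≢i = ⊥-elim (i≢i refl)

count-other : ∀ {n} {i x : Fin n} w → i ≢ x → count i (x ∷ w) ≡ count i w
count-other {i = i} {x} w i≢x with i F.≟ x
... | yes i≡x = ⊥-elim (i≢x i≡x)
... | no _ = refl

data TopView {N : ℕ} : Fin (suc N) → Set where
  top : TopView (fromℕ N)
  old : (i : Fin N) → TopView (inject₁ i)

topView : ∀ {N} (x : Fin (suc N)) → TopView x
topView {zero} F.zero = top
topView {suc N} F.zero = old F.zero
topView {suc N} (F.suc x) with topView x
... | top = top
... | old i = old (F.suc i)

old<top : ∀ {N} (i : Fin N) → inject₁ i F.< fromℕ N
old<top {N} i rewrite FP.toℕ-inject₁ i | FP.toℕ-fromℕ N = FP.toℕ<n i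

old≢top : ∀ {N} (i : Fin N) → inject₁ i ≢ fromℕ N
old≢top i eq = FP.fromℕ≢inject₁ (sym eq)

top-maximal : ∀ {N} (j : Fin (suc N)) → ¬ (fromℕ N F.< j)
top-maximal j lt = <⇒≱ lt (FP.≤fromℕ j)

inject₁-<-mono : ∀ {N} {i j : Fin N} → i F.< j → inject₁ i F.< inject₁ j
inject₁-<-mono {i = i} {j} lt rewrite FP.toℕ-inject₁ i | FP.toℕ-inject₁ j = lt

inject₁-<-reflect : ∀ {N} {i j : Fin N} → inject₁ i F.< inject₁ j → i F.< j
inject₁-<-reflect {i = i} {j} lt rewrite FP.toℕ-inject₁ i | FP.toℕ-inject₁ j = lt

ZeroOr≥ : ℕ → ℕ → Set
ZeroOr≥ d c = c ≡ 0 ⊎ d ≤ c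

Saturated : ∀ {n} → ℕ → List (Fin n) → Set
Saturated {n} d v = (i : Fin n) → ZeroOr≥ d (count i v)

saturated-0 : ∀ {n} (v : List (Fin n)) → Saturated 0 v
saturated-0 v i = inj₂ z≤n

saturated-1 : ∀ {n} (v : List (Fin n)) → Saturated 1 v
saturated-1 v i with count i v
... | zero = inj₁ refl
... | suc _ = inj₂ (s≤s z≤n)

saturated-complete : ∀ {n} (v : List (Fin n)) → (∀ i → count i v ≡ 3) → ∀ {d} → d ≤ 3 → Saturated d v
saturated-complete v three d≤3 i = inj₂ (subst (_ ≤_) (sym (three i)) d≤3)

module _ {N : ℕ} where

  count-inject₁ : (i : Fin N) (A : List (Fin N)) → count (inject₁ i) (map inject₁ A) ≡ count i A
  count-inject₁ i [] = refl
  count-inject₁ i (x ∷ A) with i F.≟ x | inject₁ i F.≟ inject₁ x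
  ... | yes _ | yes _ = cong suc (count-inject₁ i A)
  ... | no _ | no _ = count-inject₁ i A
  ... | yes i≡x | no i≢x = ⊥-elim (i≢x (cong inject₁ i≡x))
  ... | no i≢x | yes i≡x = ⊥-elim (i≢x (FP.inject₁-injective i≡x))

  count-top-map : (A : List (Fin N)) → count (fromℕ N) (map inject₁ A) ≡ 0
  count-top-map [] = refl
  count-top-map (x ∷ A) = trans (count-other (map inject₁ A) (old≢top x ∘ sym)) (count-top-map A)

  record Erases (p : List (Fin (suc N))) (v : List (Fin N)) (c : ℕ) : Set where
    constructor erases
    field
      old-count : (i : Fin N) → count (inject₁ i) p ≡ count i v
      top-count : count (fromℕ N) p ≡ c

  erases-map : ∀ v → Erases (map inject₁ v) v 0
  erases-map v = erases (λ i → count-inject₁ i v) (count-top-map v)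

  erases-++ : ∀ A {q v c} → Erases q v c → Erases (map inject₁ A ++ q) (A ++ v) c
  erases-++ A {q} {v} (erases same tp) = erases
    (λ i → trans (count-++ (inject₁ i) (map inject₁ A) q)
             (trans (cong₂ _+_ (count-inject₁ i A) (same i)) (sym (count-++ i A v))))
    (trans (count-++ (fromℕ N) (map inject₁ A) q) (trans (cong (_+ count (fromℕ N) q) (count-top-map A)) tp))

  erases-top : ∀ {q v c} → Erases q v c → Erases (fromℕ N ∷ q) v (suc c)
  erases-top {q} (erases same tp) =
    erases (λ i → trans (count-other q (old≢top i)) (same i)) (trans (count-here (fromℕ N) q) (cong suc tp))

  prefixOK-lift : ∀ {p v c} → Erases p v c → PrefixOK v → Saturated c v → PrefixOK p
  prefixOK-lift {p} (erases same tp) ok sat x with topView x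
  ... | top = inj₂ (λ j top<j → ⊥-elim (top-maximal j top<j))
  ... | old i with sat i | ok i
  ...   | inj₁ absent | _ = inj₁ (trans (same i) absent)
  ...   | inj₂ _ | inj₁ absent = inj₁ (trans (same i) absent)
  ...   | inj₂ c≤ | inj₂ dominates = inj₂ dominates′
    where
    dominates′ : (j : Fin (suc N)) → inject₁ i F.< j → count j p ≤ count (inject₁ i) p
    dominates′ j i<j with topView j
    ... | top = subst₂ _≤_ (sym tp) (sym (same i)) c≤
    ... | old j′ = subst₂ _≤_ (sym (same j′)) (sym (same i)) (dominates j′ (inject₁-<-reflect i<j))

  prefixOK-lower : ∀ {p v c} → Erases p v c → PrefixOK p → PrefixOK v × Saturated c v
  prefixOK-lower {p} {v} {c} (erases same tp) ok = ok′ , sat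
    where
    ok′ : PrefixOK v
    ok′ i with ok (inject₁ i)
    ... | inj₁ absent = inj₁ (trans (sym (same i)) absent)
    ... | inj₂ dominates = inj₂ (λ j i<j → subst₂ _≤_ (same j) (same i) (dominates (inject₁ j) (inject₁-<-mono i<j)))
    sat : Saturated c v
    sat i with ok (inject₁ i)
    ... | inj₁ absent = inj₁ (trans (sym (same i)) absent)
    ... | inj₂ dominates = inj₂ (subst₂ _≤_ tp (same i) (dominates (fromℕ N) (old<top i)))

  saturated-lift : ∀ {p v c d} → Erases p v c → Saturated d v → ZeroOr≥ d c → Saturated d p
  saturated-lift (erases same tp) sat zc x with topView x
  ... | top = subst (ZeroOr≥ _) (sym tp) zc
  ... | old i = subst (ZeroOr≥ _) (sym (same i)) (sat i)

EveryPrefix : {A : Set} → (List A → Set) → List A → Set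
EveryPrefix P w = ∀ p s → p ++ s ≡ w → P p

module _ {A : Set} where

  ep-[]⁺ : ∀ {P : List A → Set} → P [] → EveryPrefix P []
  ep-[]⁺ h [] [] refl = h

  ep-first : ∀ {P : List A → Set} {w} → EveryPrefix P w → P []
  ep-first {w = w} h = h [] w refl

  ep-whole : ∀ {P : List A → Set} {w} → EveryPrefix P w → P w
  ep-whole {w = w} h = h w [] (++-identityʳ w)

  ep-∷⁺ : ∀ {P : List A → Set} {x w} → P [] → EveryPrefix (λ p → P (x ∷ p)) w → EveryPrefix P (x ∷ w)
  ep-∷⁺ h[] h [] s eq = h[]
  ep-∷⁺ h[] h (y ∷ p) s refl = h p s refl

  ep-∷⁻ : ∀ {P : List A → Set} {x w} → EveryPrefix P (x ∷ w) → EveryPrefix (λ p → P (x ∷ p)) w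
  ep-∷⁻ {x = x} h p s eq = h (x ∷ p) s (cong (x ∷_) eq)

  ep-++⁺ : ∀ {P : List A → Set} X {Y} → EveryPrefix P X → EveryPrefix (λ p → P (X ++ p)) Y → EveryPrefix P (X ++ Y)
  ep-++⁺ [] hX hY = hY
  ep-++⁺ (x ∷ X) hX hY = ep-∷⁺ (ep-first hX) (ep-++⁺ X (ep-∷⁻ hX) hY)

  ep-++⁻ˡ : ∀ {P : List A → Set} X {Y} → EveryPrefix P (X ++ Y) → EveryPrefix P X
  ep-++⁻ˡ X {Y} h p s eq = h p (s ++ Y) (trans (sym (++-assoc p s Y)) (cong (_++ Y) eq))

  ep-++⁻ʳ : ∀ {P : List A → Set} X {Y} → EveryPrefix P (X ++ Y) → EveryPrefix (λ p → P (X ++ p)) Y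
  ep-++⁻ʳ X h p s eq = h (X ++ p) s (trans (++-assoc X p s) (cong (X ++_) eq))

  ep-map : ∀ {P Q : List A → Set} {w} → (∀ p → P p → Q p) → EveryPrefix P w → EveryPrefix Q w
  ep-map f h p s eq = f p (h p s eq)

  long-prefix : ∀ X {Y Z C : List A} → Y ++ Z ≡ X ++ C → length X ≤ length Y →
                Σ (List A) λ p → Y ≡ X ++ p × p ++ Z ≡ C
  long-prefix [] {Y} eq _ = Y , refl , eq
  long-prefix (x ∷ X) {y ∷ Y} eq (s≤s le) with ∷-injective eq
  ... | refl , eq′ with long-prefix X {Y} eq′ le
  ...   | p , refl , rest = p , refl , rest

ep-length : ∀ {A : Set} (w : List A) → EveryPrefix (λ p → length p ≤ length w) w
ep-length w p s refl = subst (length p ≤_) (sym (length-++ p)) (m≤m+n (length p) (length s))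

module _ {A B : Set} (f : A → B) where

  ep-map⁺ : ∀ {P : List B → Set} {X} → EveryPrefix (P ∘ map f) X → EveryPrefix P (map f X)
  ep-map⁺ {X = []} h = ep-[]⁺ (ep-first h)
  ep-map⁺ {P} {x ∷ X} h = ep-∷⁺ (ep-first h) (ep-map⁺ {λ p → P (f x ∷ p)} {X} (ep-∷⁻ h))

  ep-map⁻ : ∀ {P : List B → Set} {X} → EveryPrefix P (map f X) → EveryPrefix (P ∘ map f) X
  ep-map⁻ h p s eq = h (map f p) (map f s) (trans (sym (map-++ f p s)) (cong (map f) eq))

  ep-block⁺ : ∀ {P : List B → Set} X {y R} → EveryPrefix (P ∘ map f) X →
              EveryPrefix (λ p → P (map f X ++ y ∷ p)) R → EveryPrefix P (map f X ++ y ∷ R)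
  ep-block⁺ {P} X hX hR = ep-++⁺ (map f X) (ep-map⁺ {P} hX)
    (ep-∷⁺ (subst P (sym (++-identityʳ (map f X))) (ep-whole (ep-map⁺ {P} hX))) hR)

  ep-block⁻ : ∀ {P : List B → Set} X {y R} → EveryPrefix P (map f X ++ y ∷ R) →
              EveryPrefix (P ∘ map f) X × EveryPrefix (λ p → P (map f X ++ y ∷ p)) R
  ep-block⁻ {P} X h = ep-map⁻ {P} (ep-++⁻ˡ (map f X) h) , ep-∷⁻ (ep-++⁻ʳ (map f X) h)

record Threshold {n : ℕ} (u : List (Fin n)) (r : ℕ) : Set where
  constructor threshold
  field
    saturated-beyond : EveryPrefix (λ Y → r ≤ length Y → Saturated 2 Y) u
    witness          : List (Fin n)
    rest             : List (Fin n)
    witness++rest    : witness ++ rest ≡ u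
    witness-length   : suc (length witness) ≡ r
    unsaturated      : ¬ Saturated 2 witness

threshold-≤ : ∀ {n} (X C : List (Fin n)) {r} → Threshold (X ++ C) r →
              EveryPrefix (λ p → Saturated 2 (X ++ p)) C → r ≤ length X
threshold-≤ X C (threshold _ Y Z Y++Z≡ suc|Y|≡r unsat) saturated with length X ≤? length Y
... | yes |X|≤|Y| with long-prefix X {Y} Y++Z≡ |X|≤|Y|
...   | p , refl , p++Z≡C = ⊥-elim (unsat (saturated p Z p++Z≡C))
threshold-≤ X C (threshold _ Y Z _ suc|Y|≡r _) _ | no |X|≰|Y| = subst (_≤ length X) suc|Y|≡r (≰⇒> |X|≰|Y|)

beyond-threshold : ∀ {n} (X C : List (Fin n)) {r} → Threshold (X ++ C) r → r ≤ length X →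
                   EveryPrefix (λ p → Saturated 2 (X ++ p)) C
beyond-threshold X C t r≤|X| = ep-map (λ p beyond → beyond (≤-trans r≤|X| (length-++-≤ˡ X)))
                                 (ep-++⁻ʳ X (Threshold.saturated-beyond t))

threshold-unique : ∀ {n} {u : List (Fin n)} {r r′} → Threshold u r → Threshold u r′ → r ≡ r′
threshold-unique t t′ = ≤-antisym (below t t′) (below t′ t)
  where
  below : ∀ {u r r′} → Threshold u r → Threshold u r′ → r ≤ r′
  below {r′ = r′} (threshold _ Y Z Y++Z≡u suc|Y|≡r unsat) t′ with r′ ≤? length Y
  ... | yes r′≤|Y| = ⊥-elim (unsat (Threshold.saturated-beyond t′ Y Z Y++Z≡u r′≤|Y|))
  ... | no r′≰|Y| = subst (_≤ r′) suc|Y|≡r (≰⇒> r′≰|Y|)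

module _ {N : ℕ} where

  private
    ⊤ : Fin (suc N)
    ⊤ = fromℕ N

  withTops : (A B C : List (Fin N)) → List (Fin (suc N))
  withTops A B C = map inject₁ A ++ ⊤ ∷ map inject₁ B ++ ⊤ ∷ map inject₁ C ++ ⊤ ∷ []

  length-block : (A : List (Fin N)) (q : List (Fin (suc N))) →
                 length (map inject₁ A ++ ⊤ ∷ q) ≡ length A + suc (length q)
  length-block A q = trans (length-++ (map inject₁ A)) (cong (_+ suc (length q)) (length-map inject₁ A))

  length-withTops : ∀ A B C → length (withTops A B C) ≡ 3 + length (A ++ B ++ C)
  length-withTops A B C = begin
      length (withTops A B C)
    ≡⟨ length-block A _ ⟩
      length A + suc (length (map inject₁ B ++ ⊤ ∷ map inject₁ C ++ ⊤ ∷ []))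
    ≡⟨ cong (λ z → length A + suc z) (length-block B _) ⟩
      length A + suc (length B + suc (length (map inject₁ C ++ ⊤ ∷ [])))
    ≡⟨ cong (λ z → length A + suc (length B + suc z)) (trans (length-block C []) (+-comm (length C) 1)) ⟩
      length A + suc (length B + suc (suc (length C)))
    ≡⟨ solve 3 (λ a b c → a :+ (con 1 :+ (b :+ (con 2 :+ c))) := con 3 :+ (a :+ (b :+ c))) refl
         (length A) (length B) (length C) ⟩
      3 + (length A + (length B + length C))
    ≡⟨ cong (3 +_) (sym (trans (length-++ A) (cong (length A +_) (length-++ B)))) ⟩
      3 + length (A ++ B ++ C)
    ∎
    where
    open ≡-Reasoning
    open +-*-Solver

  block-injective : ∀ (A A′ : List (Fin N)) {R R′} → map inject₁ A ++ ⊤ ∷ R ≡ map inject₁ A′ ++ ⊤ ∷ R′ →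
                    A ≡ A′ × R ≡ R′
  block-injective [] [] refl = refl , refl
  block-injective [] (a ∷ A′) eq = ⊥-elim (old≢top a (sym (proj₁ (∷-injective eq))))
  block-injective (a ∷ A) [] eq = ⊥-elim (old≢top a (proj₁ (∷-injective eq)))
  block-injective (a ∷ A) (a′ ∷ A′) eq with ∷-injective eq
  ... | a≡a′ , eq′ with block-injective A A′ eq′ | FP.inject₁-injective a≡a′
  ...   | refl , R≡R′ | refl = refl , R≡R′

  withTops-injective : ∀ {A B C A′ B′ C′} → withTops A B C ≡ withTops A′ B′ C′ → A ≡ A′ × B ≡ B′ × C ≡ C′
  withTops-injective {A} {B} {C} {A′} {B′} {C′} eq with block-injective A A′ eq
  ... | refl , eq₂ with block-injective B B′ eq₂
  ...   | refl , eq₃ with block-injective C C′ eq₃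
  ...     | refl , _ = refl , refl , refl

  erases-second-block : ∀ A p → Erases (map inject₁ A ++ ⊤ ∷ map inject₁ p) (A ++ p) 1
  erases-second-block A p = erases-++ A (erases-top (erases-map p))

  erases-third-block : ∀ A B p → Erases (map inject₁ A ++ ⊤ ∷ map inject₁ B ++ ⊤ ∷ map inject₁ p) (A ++ B ++ p) 2
  erases-third-block A B p = erases-++ A (erases-top (erases-++ B (erases-top (erases-map p))))

  erases-withTops : ∀ A B C → Erases (withTops A B C) (A ++ B ++ C) 3
  erases-withTops A B C = subst (λ v → Erases (withTops A B C) v 3) (cong (λ z → A ++ B ++ z) (++-identityʳ C))
    (erases-++ A (erases-top (erases-++ B (erases-top (erases-++ C (erases-top (erases-map [])))))))

  withTops-prefixes⁺ : ∀ {P : List (Fin (suc N)) → Set} A B C →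
    EveryPrefix (P ∘ map inject₁) A →
    EveryPrefix (λ p → P (map inject₁ A ++ ⊤ ∷ map inject₁ p)) B →
    EveryPrefix (λ p → P (map inject₁ A ++ ⊤ ∷ map inject₁ B ++ ⊤ ∷ map inject₁ p)) C →
    P (withTops A B C) → EveryPrefix P (withTops A B C)
  withTops-prefixes⁺ A B C hA hB hC hW =
    ep-block⁺ inject₁ A hA (ep-block⁺ inject₁ B hB (ep-block⁺ inject₁ C hC (ep-[]⁺ hW)))

  withTops-prefixes⁻ : ∀ {P : List (Fin (suc N)) → Set} A B C → EveryPrefix P (withTops A B C) →
    EveryPrefix (P ∘ map inject₁) A ×
    EveryPrefix (λ p → P (map inject₁ A ++ ⊤ ∷ map inject₁ p)) B ×
    EveryPrefix (λ p → P (map inject₁ A ++ ⊤ ∷ map inject₁ B ++ ⊤ ∷ map inject₁ p)) C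
  withTops-prefixes⁻ A B C h with ep-block⁻ inject₁ A h
  ... | hA , h′ with ep-block⁻ inject₁ B h′
  ...   | hB , h″ = hA , hB , proj₁ (ep-block⁻ inject₁ C h″)

  all-three-lift : ∀ {p : List (Fin (suc N))} {v : List (Fin N)} → Erases p v 3 → (∀ i → count i v ≡ 3) → ∀ x → count x p ≡ 3
  all-three-lift (erases same tp) three x with topView x
  ... | top = tp
  ... | old i = trans (same i) (three i)

  all-three-lower : ∀ {p : List (Fin (suc N))} {v : List (Fin N)} → Erases p v 3 → (∀ x → count x p ≡ 3) → ∀ i → count i v ≡ 3
  all-three-lower (erases same tp) three i = trans (sym (same i)) (three (inject₁ i))

  withTops-valid : ∀ A B C → InA N (A ++ B ++ C) →
                   EveryPrefix (λ p → Saturated 2 (A ++ B ++ p)) C → InA (suc N) (withTops A B C)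
  withTops-valid A B C (three , ok) late =
    all-three-lift (erases-withTops A B C) three ,
    withTops-prefixes⁺ A B C
      (ep-map (λ p okp → prefixOK-lift (erases-map p) okp (saturated-0 p)) (ep-++⁻ˡ A ok))
      (ep-map (λ p okp → prefixOK-lift (erases-second-block A p) okp (saturated-1 (A ++ p))) (ep-++⁻ˡ B (ep-++⁻ʳ A ok)))
      (λ p s eq → prefixOK-lift (erases-third-block A B p) (ep-++⁻ʳ B (ep-++⁻ʳ A ok) p s eq) (late p s eq))
      (prefixOK-lift (erases-withTops A B C) (ep-whole ok) (saturated-complete (A ++ B ++ C) three (s≤s (s≤s (s≤s z≤n)))))

  -- ... and its threshold is |A| + |B| + 2: the prefix  A ⊤ B  has only one ⊤.
  withTops-threshold : ∀ A B C → InA N (A ++ B ++ C) → EveryPrefix (λ p → Saturated 2 (A ++ B ++ p)) C →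
                       Threshold (withTops A B C) (suc (length A + suc (length B)))
  withTops-threshold A B C (three , _) late = threshold
    (withTops-prefixes⁺ A B C
      (ep-map (λ p |p|≤|A| r≤ → ⊥-elim (short (subst (_≤ _) (sym (length-map inject₁ p))
                                           (≤-trans |p|≤|A| (m≤m+n (length A) _))) r≤)) (ep-length A))
      (ep-map (λ p |p|≤|B| r≤ → ⊥-elim (short (subst (_≤ _) (sym (length-block A (map inject₁ p)))
                                           (+-monoʳ-≤ (length A) (s≤s (subst (_≤ length B) (sym (length-map inject₁ p)) |p|≤|B|)))) r≤))
              (ep-length B))
      (λ p s eq _ → saturated-lift (erases-third-block A B p) (late p s eq) (inj₂ ≤-refl))
      (λ _ → saturated-lift (erases-withTops A B C) (saturated-complete (A ++ B ++ C) three 2≤3) (inj₂ 2≤3)))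
    (map inject₁ A ++ ⊤ ∷ map inject₁ B) (⊤ ∷ map inject₁ C ++ ⊤ ∷ []) (++-assoc (map inject₁ A) (⊤ ∷ map inject₁ B) _)
    (cong suc (trans (length-block A (map inject₁ B)) (cong (λ z → length A + suc z) (length-map inject₁ B))))
    one-top
    where
    2≤3 : 2 ≤ 3
    2≤3 = s≤s (s≤s z≤n)
    short : ∀ {ℓ} → ℓ ≤ length A + suc (length B) → ¬ (suc (length A + suc (length B)) ≤ ℓ)
    short ℓ≤ r≤ = <-irrefl refl (≤-trans r≤ ℓ≤)
    one-top : ¬ Saturated 2 (map inject₁ A ++ ⊤ ∷ map inject₁ B)
    one-top saturated with saturated ⊤ | Erases.top-count (erases-second-block A B)
    ... | inj₁ absent | once = 1+n≢0 (trans (sym once) absent)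
    ... | inj₂ 2≤ | once = <-irrefl refl (subst (2 ≤_) once 2≤)

  split-at-top : ∀ (w : List (Fin (suc N))) {c} → count ⊤ w ≡ suc c →
                 Σ (List (Fin N)) λ A → Σ (List (Fin (suc N))) λ R → w ≡ map inject₁ A ++ ⊤ ∷ R × count ⊤ R ≡ c
  split-at-top (x ∷ w) e with topView x
  ... | top = [] , w , refl , suc-injective (trans (sym (count-here ⊤ w)) e)
  ... | old i with split-at-top w (trans (sym (count-other w (old≢top i ∘ sym))) e)
  ...   | A , R , refl , e′ = i ∷ A , R , refl , e′

  no-top : ∀ (w : List (Fin (suc N))) → count ⊤ w ≡ 0 → Σ (List (Fin N)) λ D → w ≡ map inject₁ D
  no-top [] _ = [] , refl
  no-top (x ∷ w) e with topView x
  ... | top = ⊥-elim (1+n≢0 (trans (sym (count-here ⊤ w)) e))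
  ... | old i with no-top w (trans (sym (count-other w (old≢top i ∘ sym))) e)
  ...   | D , refl = i ∷ D , refl

  -- In a valid word nothing follows the third ⊤: a letter d there would occur
  -- at least twice before it (saturation at d), hence three times before the
  -- third ⊤ (saturation at the third ⊤), hence four times in all.
  nothing-after-third-top : ∀ A B C D →
    InA (suc N) (map inject₁ A ++ ⊤ ∷ map inject₁ B ++ ⊤ ∷ map inject₁ C ++ ⊤ ∷ map inject₁ D) → D ≡ []
  nothing-after-third-top A B C [] _ = refl
  nothing-after-third-top A B C (d ∷ D) (three , ok) =
    ⊥-elim (too-many (count d (A ++ B ++ C)) (count d D)
      (subst (ZeroOr≥ 3) (count-after 0 [] refl) (saturated-at [] (ep-first after)))
      (subst (ZeroOr≥ 3) (count-after 1 (d ∷ []) (count-here d [])) (saturated-at (d ∷ []) (ep-first (ep-∷⁻ after))))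
      (trans (sym (count-after (suc (count d D)) (d ∷ D) (count-here d D)))
        (trans (sym (Erases.old-count (erasure (d ∷ D)) d)) (three (inject₁ d)))))
    where
    upToThird : List (Fin (suc N)) → List (Fin (suc N))
    upToThird q = map inject₁ A ++ ⊤ ∷ map inject₁ B ++ ⊤ ∷ map inject₁ C ++ ⊤ ∷ q
    after : EveryPrefix (PrefixOK ∘ upToThird) (map inject₁ (d ∷ D))
    after = proj₂ (ep-block⁻ inject₁ C (proj₂ (ep-block⁻ inject₁ B (proj₂ (ep-block⁻ inject₁ A ok)))))
    erasure : ∀ q → Erases (upToThird (map inject₁ q)) (A ++ B ++ C ++ q) 3
    erasure q = erases-++ A (erases-top (erases-++ B (erases-top (erases-++ C (erases-top (erases-map q))))))
    saturated-at : ∀ q → PrefixOK (upToThird (map inject₁ q)) → ZeroOr≥ 3 (count d (A ++ B ++ C ++ q))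
    saturated-at q okq = proj₂ (prefixOK-lower (erasure q) okq) d
    count-after : ∀ k q → count d q ≡ k → count d (A ++ B ++ C ++ q) ≡ count d (A ++ B ++ C) + k
    count-after k q eq = begin
      count d (A ++ B ++ C ++ q)   ≡⟨ cong (λ z → count d (A ++ z)) (sym (++-assoc B C q)) ⟩
      count d (A ++ (B ++ C) ++ q) ≡⟨ cong (count d) (sym (++-assoc A (B ++ C) q)) ⟩
      count d ((A ++ B ++ C) ++ q) ≡⟨ count-++ d (A ++ B ++ C) q ⟩
      count d (A ++ B ++ C) + count d q ≡⟨ cong (count d (A ++ B ++ C) +_) eq ⟩
      count d (A ++ B ++ C) + k ∎
      where open ≡-Reasoning
    too-many : ∀ c e → ZeroOr≥ 3 (c + 0) → ZeroOr≥ 3 (c + 1) → c + suc e ≡ 3 → ⊥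
    too-many 0 e _ (inj₁ ())
    too-many 0 e _ (inj₂ (s≤s ()))
    too-many 1 e _ (inj₂ (s≤s (s≤s ())))
    too-many 2 e (inj₂ (s≤s (s≤s ()))) _ _
    too-many (suc (suc (suc c))) e _ _ eq = 1+n≢0 (trans (sym (+-suc c e)) (suc-injective (suc-injective (suc-injective eq))))

  decompose : ∀ w → InA (suc N) w → Σ (List (Fin N)) λ A → Σ (List (Fin N)) λ B → Σ (List (Fin N)) λ C →
              w ≡ withTops A B C
  decompose w valid with split-at-top w (proj₁ valid ⊤)
  ... | A , R₁ , refl , e₁ with split-at-top R₁ e₁
  ...   | B , R₂ , refl , e₂ with split-at-top R₂ e₂
  ...     | C , R₃ , refl , e₃ with no-top R₃ e₃
  ...       | D , refl with nothing-after-third-top A B C D valid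
  ...         | refl = A , B , C , refl

  withTops-erasure : ∀ A B C → InA (suc N) (withTops A B C) →
                     InA N (A ++ B ++ C) × EveryPrefix (λ p → Saturated 2 (A ++ B ++ p)) C
  withTops-erasure A B C (three , ok) with withTops-prefixes⁻ A B C ok
  ... | okA , okB , okC =
    (all-three-lower (erases-withTops A B C) three ,
     ep-++⁺ A (ep-map (λ p → proj₁ ∘ prefixOK-lower (erases-map p)) okA)
       (ep-++⁺ B (ep-map (λ p → proj₁ ∘ prefixOK-lower (erases-second-block A p)) okB)
         (ep-map (λ p → proj₁ ∘ prefixOK-lower (erases-third-block A B p)) okC))) ,
    ep-map (λ p → proj₂ ∘ prefixOK-lower (erases-third-block A B p)) okC

module _ {A : Set} where

  splits : List A → List (List A × List A)
  splits [] = ([] , []) ∷ []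
  splits (x ∷ X) = ([] , x ∷ X) ∷ map (λ PQ → x ∷ proj₁ PQ , proj₂ PQ) (splits X)

  splits-sound : ∀ X {PQ} → PQ ∈ splits X → proj₁ PQ ++ proj₂ PQ ≡ X
  splits-sound [] (here refl) = refl
  splits-sound (x ∷ X) (here refl) = refl
  splits-sound (x ∷ X) (there m) with ∈-map⁻ (λ PQ → x ∷ proj₁ PQ , proj₂ PQ) m
  ... | _ , m′ , refl = cong (x ∷_) (splits-sound X m′)

  splits-complete : ∀ (P Q : List A) → (P , Q) ∈ splits (P ++ Q)
  splits-complete [] [] = here refl
  splits-complete [] (x ∷ Q) = here refl
  splits-complete (x ∷ P) Q = there (∈-map⁺ (λ PQ → x ∷ proj₁ PQ , proj₂ PQ) (splits-complete P Q))

  splits-length : ∀ X → length (splits X) ≡ suc (length X)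
  splits-length [] = refl
  splits-length (x ∷ X) = cong suc (trans (length-map _ (splits X)) (splits-length X))

  splits-unique : ∀ X → Unique (splits X)
  splits-unique [] = [] ∷ []
  splits-unique (x ∷ X) = AllP.map⁺ (All.universal (λ _ ()) (splits X)) ∷ UniqueP.map⁺ cons-injective (splits-unique X)
    where
    cons-injective : ∀ {PQ PQ′ : List A × List A} → (x ∷ proj₁ PQ , proj₂ PQ) ≡ (x ∷ proj₁ PQ′ , proj₂ PQ′) → PQ ≡ PQ′
    cons-injective {_ , _} {_ , _} refl = refl

  take-length : ∀ (X Y : List A) → take (length X) (X ++ Y) ≡ X
  take-length [] Y = refl
  take-length (x ∷ X) Y = cong (x ∷_) (take-length X Y)

  drop-length : ∀ (X Y : List A) → drop (length X) (X ++ Y) ≡ Y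
  drop-length [] Y = refl
  drop-length (x ∷ X) Y = drop-length X Y

  concatUpTo : ℕ → (ℕ → List A) → List A
  concatUpTo zero f = []
  concatUpTo (suc k) f = concatUpTo k f ++ f (suc k)

  concatUpTo⁻ : ∀ k f {u} → u ∈ concatUpTo k f → Σ ℕ λ i → i ≤ k × u ∈ f i
  concatUpTo⁻ (suc k) f m with ∈-++⁻ (concatUpTo k f) m
  ... | inj₁ m′ = let i , i≤k , mi = concatUpTo⁻ k f m′ in i , m≤n⇒m≤1+n i≤k , mi
  ... | inj₂ m′ = suc k , ≤-refl , m′

  concatUpTo⁺ : ∀ k f {u i} → 1 ≤ i → i ≤ k → u ∈ f i → u ∈ concatUpTo k f
  concatUpTo⁺ zero f () z≤n m
  concatUpTo⁺ (suc k) f {i = i} 1≤i i≤k m with i ≟ suc k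
  ... | yes refl = ∈-++⁺ʳ (concatUpTo k f) m
  ... | no i≢k = ∈-++⁺ˡ (concatUpTo⁺ k f 1≤i (≤-pred (≤∧≢⇒< i≤k i≢k)) m)

  length-concatUpTo : ∀ k f → length (concatUpTo k f) ≡ sum1 k (length ∘ f)
  length-concatUpTo zero f = refl
  length-concatUpTo (suc k) f = trans (length-++ (concatUpTo k f)) (cong (_+ length (f (suc k))) (length-concatUpTo k f))

  concatUpTo-unique : ∀ k f → (∀ i → Unique (f i)) → (∀ i j {u} → u ∈ f i → u ∈ f j → i ≡ j) →
                      Unique (concatUpTo k f)
  concatUpTo-unique zero f _ _ = []
  concatUpTo-unique (suc k) f unique determined =
    UniqueP.++⁺ (concatUpTo-unique k f unique determined) (unique (suc k)) disjoint
    where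
    disjoint : ∀ {v} → ¬ (v ∈ concatUpTo k f × v ∈ f (suc k))
    disjoint (m₁ , m₂) with concatUpTo⁻ k f m₁
    ... | i , i≤k , mi = <-irrefl (determined i (suc k) mi m₂) (s≤s i≤k)

module _ {A B : Set} (f : A → List B) where

  concatMap⁻ : ∀ xs {y} → y ∈ concatMap f xs → Σ A λ x → x ∈ xs × y ∈ f x
  concatMap⁻ xs m = find (∈-concatMap⁻ f m)

  concatMap⁺ : ∀ {xs x y} → x ∈ xs → y ∈ f x → y ∈ concatMap f xs
  concatMap⁺ mx my = ∈-concatMap⁺ f (lose mx my)

  length-concatMap : ∀ xs c → (∀ {x} → x ∈ xs → length (f x) ≡ c) → length (concatMap f xs) ≡ length xs * c
  length-concatMap [] c _ = refl
  length-concatMap (x ∷ xs) c len = trans (length-++ (f x)) (cong₂ _+_ (len (here refl)) (length-concatMap xs c (len ∘ there)))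

  concatMap-unique : ∀ xs → Unique xs → (∀ {x} → x ∈ xs → Unique (f x)) →
                     (∀ {x x′ y} → y ∈ f x → y ∈ f x′ → x ≡ x′) → Unique (concatMap f xs)
  concatMap-unique [] _ _ _ = []
  concatMap-unique (x ∷ xs) (x∉xs ∷ unique-xs) unique determined =
    UniqueP.++⁺ (unique (here refl)) (concatMap-unique xs unique-xs (unique ∘ there) determined) disjoint
    where
    disjoint : ∀ {v} → ¬ (v ∈ f x × v ∈ concatMap f xs)
    disjoint (m₁ , m₂) with concatMap⁻ xs m₂
    ... | x′ , mx′ , my = All.lookup x∉xs mx′ (determined m₁ my)

module _ {N : ℕ} where

  insertions : ℕ → List (Fin N) → List (List (Fin (suc N)))
  insertions h u = map (λ AB → withTops (proj₁ AB) (proj₂ AB) (drop h u)) (splits (take h u))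

  insertions-sound : ∀ h u {w} → w ∈ insertions h u →
    Σ (List (Fin N)) λ A → Σ (List (Fin N)) λ B → A ++ B ≡ take h u × w ≡ withTops A B (drop h u)
  insertions-sound h u m with ∈-map⁻ (λ AB → withTops (proj₁ AB) (proj₂ AB) (drop h u)) m
  ... | (A , B) , m′ , refl = A , B , splits-sound (take h u) m′ , refl

  withTops∈insertions : ∀ (A B C : List (Fin N)) → withTops A B C ∈ insertions (length (A ++ B)) (A ++ B ++ C)
  withTops∈insertions A B C rewrite sym (++-assoc A B C) | take-length (A ++ B) C | drop-length (A ++ B) C =
    ∈-map⁺ (λ AB → withTops (proj₁ AB) (proj₂ AB) C) (splits-complete A B)

  insertions-determined : ∀ h {u u′ w} → w ∈ insertions h u → w ∈ insertions h u′ → u ≡ u′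
  insertions-determined h {u} {u′} m m′ with insertions-sound h u m | insertions-sound h u′ m′
  ... | A , B , AB≡ , refl | A′ , B′ , A′B′≡ , eq with withTops-injective eq
  ...   | refl , refl , drops≡ = begin
      u                          ≡⟨ take++drop≡id h u ⟨
      take h u ++ drop h u       ≡⟨ cong₂ _++_ (trans (sym AB≡) A′B′≡) drops≡ ⟩
      take h u′ ++ drop h u′     ≡⟨ take++drop≡id h u′ ⟩
      u′                         ∎
    where open ≡-Reasoning

  insertions-unique : ∀ h u → Unique (insertions h u)
  insertions-unique h u = UniqueP.map⁺ split-injective (splits-unique (take h u))
    where
    split-injective : ∀ {AB A′B′ : List (Fin N) × List (Fin N)} →
      withTops (proj₁ AB) (proj₂ AB) (drop h u) ≡ withTops (proj₁ A′B′) (proj₂ A′B′) (drop h u) → AB ≡ A′B′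
    split-injective {_ , _} {_ , _} eq with withTops-injective eq
    ... | refl , refl , _ = refl

  length-insertions : ∀ h u → h ≤ length u → length (insertions h u) ≡ suc h
  length-insertions h u h≤ = begin
      length (insertions h u)   ≡⟨ length-map _ (splits (take h u)) ⟩
      length (splits (take h u)) ≡⟨ splits-length (take h u) ⟩
      suc (length (take h u))   ≡⟨ cong suc (trans (length-take h u) (m≤n⇒m⊓n≡m h≤)) ⟩
      suc h                     ∎
    where open ≡-Reasoning

-- G N k lists, without repetition, the words of 𝒜_N with threshold (k - 1) + 2N;
-- these k range over 1 … N.  Its recursion mirrors the recursion of b.
G : (N : ℕ) → ℕ → List (List (Fin N))
G zero k = []
G (suc zero) k = if ⌊ k ℕ.≟ 1 ⌋ then (F.zero ∷ F.zero ∷ F.zero ∷ []) ∷ [] else []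
G (suc (suc n)) zero = []
G (suc (suc n)) (suc m) =
  if ⌊ suc m ≤? suc (suc n) ⌋ then concatMap (insertions (m + 2 * suc n)) (concatUpTo (suc m) (G (suc n))) else []

record InClass (N k : ℕ) (u : List (Fin N)) : Set where
  constructor inClass
  field
    valid         : InA N u
    length≡       : length u ≡ 3 * N
    rank          : ℕ
    k≡1+rank      : k ≡ suc rank
    has-threshold : Threshold u (rank + 2 * N)
    k≤N           : k ≤ N

class-positive : ∀ {N k u} → InClass N k u → 1 ≤ k
class-positive (inClass _ _ _ refl _ _) = s≤s z≤n

class-determined : ∀ {N i j u} → InClass N i u → InClass N j u → i ≡ j
class-determined (inClass _ _ r refl t _) (inClass _ _ r′ refl t′ _) =
  cong suc (+-cancelʳ-≡ _ r r′ (threshold-unique t t′))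

record Invariant (N : ℕ) : Set where
  field
    sound    : ∀ k {u} → u ∈ G N k → InClass N k u
    complete : ∀ u → InA N u → Σ ℕ λ k → u ∈ G N k
    unique   : ∀ k → Unique (G N k)
    size     : ∀ k → length (G N k) ≡ b N k

module OneLetter where

  ω₁³ : List (Fin 1)
  ω₁³ = F.zero ∷ F.zero ∷ F.zero ∷ []

  ω₁³-valid : InA 1 ω₁³
  ω₁³-valid = (λ { F.zero → refl }) , (λ p s _ → ok p)
    where
    ok : ∀ (p : List (Fin 1)) → PrefixOK p
    ok p F.zero = inj₂ (λ { F.zero () })

  ω₁³-threshold : Threshold ω₁³ 2
  ω₁³-threshold = threshold beyond (F.zero ∷ []) (F.zero ∷ F.zero ∷ []) refl refl once
    where
    beyond : EveryPrefix (λ Y → 2 ≤ length Y → Saturated 2 Y) ω₁³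
    beyond (F.zero ∷ F.zero ∷ _) _ _ _ F.zero = inj₂ (s≤s (s≤s z≤n))
    beyond (F.zero ∷ []) _ _ (s≤s ())
    once : ¬ Saturated 2 (F.zero ∷ [])
    once saturated with saturated F.zero
    ... | inj₂ (s≤s ())

  only-ω₁³ : ∀ (u : List (Fin 1)) → count F.zero u ≡ 3 → u ≡ ω₁³
  only-ω₁³ (F.zero ∷ F.zero ∷ F.zero ∷ []) _ = refl
  only-ω₁³ (F.zero ∷ F.zero ∷ F.zero ∷ F.zero ∷ _) ()

  invariant : Invariant 1
  invariant = record { sound = sound ; complete = complete ; unique = unique ; size = size }
    where
    sound : ∀ k {u} → u ∈ G 1 k → InClass 1 k u
    sound k m with k ℕ.≟ 1
    sound .1 (here refl) | yes refl = inClass ω₁³-valid refl 0 refl ω₁³-threshold (s≤s z≤n)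
    complete : ∀ u → InA 1 u → Σ ℕ λ k → u ∈ G 1 k
    complete u (three , _) with only-ω₁³ u (three F.zero)
    ... | refl = 1 , here refl
    unique : ∀ k → Unique (G 1 k)
    unique k with k ℕ.≟ 1
    ... | yes _ = [] ∷ []
    ... | no _ = []
    size : ∀ k → length (G 1 k) ≡ b 1 k
    size k with k ℕ.≟ 1
    ... | yes _ = refl
    ... | no _ = refl

-- Inserting top letters into a word u of class k, with the first h = m + 2N
-- letters before the second ⊤ (k ≤ m + 1 makes h at least the threshold),
-- gives a word of class m + 1 of 𝒜_{N+1}.
insertion-class : ∀ {N k m u w} → InClass N k u → k ≤ suc m → m ≤ N →
                  w ∈ insertions (m + 2 * N) u → InClass (suc N) (suc m) w
insertion-class {N} {k} {m} {u} (inClass valid |u|≡ r refl t _) k≤1+m m≤N mw with insertions-sound (m + 2 * N) u mw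
... | A , B , AB≡ , refl =
  inClass (withTops-valid A B C valid′ late) length-withTops′ m refl
    (subst (Threshold _) threshold≡ (withTops-threshold A B C valid′ late)) (s≤s m≤N)
  where
  h : ℕ
  h = m + 2 * N
  C : List (Fin N)
  C = drop h u
  u≡ : u ≡ (A ++ B) ++ C
  u≡ = trans (sym (take++drop≡id h u)) (cong (_++ C) (sym AB≡))
  valid′ : InA N (A ++ B ++ C)
  valid′ = subst (InA N) (trans u≡ (++-assoc A B C)) valid
  |AB|≡h : length (A ++ B) ≡ h
  |AB|≡h = trans (cong length AB≡) (trans (length-take h u)
             (m≤n⇒m⊓n≡m (subst (h ≤_) (sym |u|≡) (+-monoˡ-≤ (2 * N) m≤N))))
  late : EveryPrefix (λ p → Saturated 2 (A ++ B ++ p)) C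
  late = ep-map (λ p → subst (Saturated 2) (++-assoc A B p))
    (beyond-threshold (A ++ B) C (subst (λ v → Threshold v _) u≡ t)
      (subst (r + 2 * N ≤_) (sym |AB|≡h) (+-monoˡ-≤ (2 * N) (≤-pred k≤1+m))))
  length-withTops′ : length (withTops A B C) ≡ 3 * suc N
  length-withTops′ = begin
    length (withTops A B C)    ≡⟨ length-withTops A B C ⟩
    3 + length (A ++ B ++ C)   ≡⟨ cong ((3 +_) ∘ length) (++-assoc A B C) ⟨
    3 + length ((A ++ B) ++ C) ≡⟨ cong ((3 +_) ∘ length) u≡ ⟨
    3 + length u               ≡⟨ cong (3 +_) |u|≡ ⟩
    3 + 3 * N                  ≡⟨ *-suc 3 N ⟨
    3 * suc N                  ∎
    where open ≡-Reasoning
  threshold≡ : suc (length A + suc (length B)) ≡ m + 2 * suc N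
  threshold≡ = begin
    suc (length A + suc (length B)) ≡⟨ cong suc (+-suc (length A) (length B)) ⟩
    2 + (length A + length B)       ≡⟨ cong (2 +_) (trans (sym (length-++ A)) |AB|≡h) ⟩
    2 + (m + 2 * N)                 ≡⟨ solve 2 (λ m N → con 2 :+ (m :+ con 2 :* N) := m :+ con 2 :* (con 1 :+ N)) refl m N ⟩
    m + 2 * suc N                   ∎
    where
    open ≡-Reasoning
    open +-*-Solver

-- Conversely, if A ⊤ B ⊤ C ⊤ is valid and A B C has class k, then
-- |A B| = m + 2N for some m with k ≤ m + 1 ≤ N + 1: the threshold of A B C is
-- at most |A B| since the second ⊤ comes late, and |A B| ≤ |A B C| = 3N.
origin-rank : ∀ {N k} A B C → InClass N k (A ++ B ++ C) → EveryPrefix (λ p → Saturated 2 (A ++ B ++ p)) C →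
              Σ ℕ λ m → m + 2 * N ≡ length (A ++ B) × k ≤ suc m × m ≤ N
origin-rank {N} A B C (inClass _ |ABC|≡ r refl t _) late = m , m+2N≡ , s≤s r≤m , m≤N
  where
  r+2N≤ : r + 2 * N ≤ length (A ++ B)
  r+2N≤ = threshold-≤ (A ++ B) C (subst (λ v → Threshold v _) (sym (++-assoc A B C)) t)
            (ep-map (λ p → subst (Saturated 2) (sym (++-assoc A B p))) late)
  m : ℕ
  m = length (A ++ B) ∸ 2 * N
  m+2N≡ : m + 2 * N ≡ length (A ++ B)
  m+2N≡ = m∸n+n≡m (≤-trans (m≤n+m (2 * N) r) r+2N≤)
  r≤m : r ≤ m
  r≤m = +-cancelʳ-≤ (2 * N) r m (subst (r + 2 * N ≤_) (sym m+2N≡) r+2N≤)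
  m≤N : m ≤ N
  m≤N = +-cancelʳ-≤ (2 * N) m N (subst (_≤ 3 * N) (sym m+2N≡)
          (subst (length (A ++ B) ≤_) |ABC|≡
            (subst (λ v → length (A ++ B) ≤ length v) (++-assoc A B C) (length-++-≤ˡ (A ++ B)))))

sum1-cong : ∀ k {f g : ℕ → ℕ} → (∀ i → f i ≡ g i) → sum1 k f ≡ sum1 k g
sum1-cong zero _ = refl
sum1-cong (suc k) f≗g = cong₂ _+_ (sum1-cong k f≗g) (f≗g (suc k))

module Step (n : ℕ) (I : Invariant (suc n)) where

  open Invariant I

  N : ℕ
  N = suc n

  sound′ : ∀ k {w} → w ∈ G (suc N) k → InClass (suc N) k w
  sound′ (suc m) mw with suc m ≤? suc N
  ... | yes 1+m≤1+N with concatMap⁻ (insertions (m + 2 * N)) (concatUpTo (suc m) (G N)) mw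
  ...   | u , mu , mw′ with concatUpTo⁻ (suc m) (G N) mu
  ...     | k , k≤1+m , mk = insertion-class (sound k mk) k≤1+m (≤-pred 1+m≤1+N) mw′

  complete′ : ∀ w → InA (suc N) w → Σ ℕ λ k → w ∈ G (suc N) k
  complete′ w valid with decompose w valid
  ... | A , B , C , refl with withTops-erasure A B C valid
  ...   | valid′ , late with complete (A ++ B ++ C) valid′
  ...     | k , mk with origin-rank A B C (sound k mk) late
  ...       | m , m+2N≡ , k≤1+m , m≤N = suc m , membership
    where
    membership : withTops A B C ∈ G (suc N) (suc m)
    membership with suc m ≤? suc N
    ... | no 1+m≰1+N = ⊥-elim (1+m≰1+N (s≤s m≤N))
    ... | yes _ = concatMap⁺ (insertions (m + 2 * N)) (concatUpTo⁺ (suc m) (G N) (class-positive (sound k mk)) k≤1+m mk)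
                    (subst (λ h → withTops A B C ∈ insertions h (A ++ B ++ C)) (sym m+2N≡) (withTops∈insertions A B C))

  unique′ : ∀ k → Unique (G (suc N) k)
  unique′ zero = []
  unique′ (suc m) with suc m ≤? suc N
  ... | no _ = []
  ... | yes _ = concatMap-unique (insertions (m + 2 * N)) (concatUpTo (suc m) (G N))
                  (concatUpTo-unique (suc m) (G N) unique (λ i j mi mj → class-determined (sound i mi) (sound j mj)))
                  (λ _ → insertions-unique (m + 2 * N) _) (insertions-determined (m + 2 * N))

  size′ : ∀ k → length (G (suc N) k) ≡ b (suc N) k
  size′ zero = refl
  size′ (suc m) with suc m ≤? suc N
  ... | no _ = refl
  ... | yes 1+m≤1+N = begin
      length (concatMap (insertions h) U)  ≡⟨ length-concatMap (insertions h) U (suc h) each ⟩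
      length U * suc h                     ≡⟨ *-comm (length U) (suc h) ⟩
      suc h * length U                     ≡⟨ cong₂ _*_ factor (trans (length-concatUpTo (suc m) (G N)) (sum1-cong (suc m) size)) ⟩
      (2 * suc N + suc m ∸ 2) * sum1 (suc m) (b N) ∎
    where
    open ≡-Reasoning
    h : ℕ
    h = m + 2 * N
    U : List (List (Fin N))
    U = concatUpTo (suc m) (G N)
    each : ∀ {u} → u ∈ U → length (insertions h u) ≡ suc h
    each mu with concatUpTo⁻ (suc m) (G N) mu
    ... | k , _ , mk = length-insertions h _ (subst (h ≤_) (sym (InClass.length≡ (sound k mk))) (+-monoˡ-≤ (2 * N) (≤-pred 1+m≤1+N)))
    factor : suc h ≡ 2 * suc N + suc m ∸ 2
    factor = solve 2 (λ n m → con 1 :+ (m :+ con 2 :* (con 1 :+ n)) := (n :+ ((con 2 :+ n) :+ con 0)) :+ (con 1 :+ m)) refl n m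
      where open +-*-Solver

  invariant : Invariant (suc N)
  invariant = record { sound = sound′ ; complete = complete′ ; unique = unique′ ; size = size′ }

invariant : ∀ n → Invariant (suc n)
invariant zero = OneLetter.invariant
invariant (suc n) = Step.invariant n (invariant n)

proposition3 : (n : ℕ) → 1 Data.Nat.≤ n →
    Σ (List (List (Fin n))) λ xs →
      Unique xs × ((w : List (Fin n)) → (w ∈ xs) ⇔ InA n w) × (length xs ≡ sum1 n (b n))
proposition3 (suc n) _ = concatUpTo (suc n) (G (suc n)) , unique-all , membership , size-all
  where
  open Invariant (invariant n)
  unique-all : Unique (concatUpTo (suc n) (G (suc n)))
  unique-all = concatUpTo-unique (suc n) (G (suc n)) unique (λ i j mi mj → class-determined (sound i mi) (sound j mj))
  membership : ∀ w → (w ∈ concatUpTo (suc n) (G (suc n))) ⇔ InA (suc n) w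
  membership w = mk⇔
    (λ mw → let k , _ , mk = concatUpTo⁻ (suc n) (G (suc n)) mw in InClass.valid (sound k mk))
    (λ valid → let k , mk = complete w valid in
               concatUpTo⁺ (suc n) (G (suc n)) (class-positive (sound k mk)) (InClass.k≤N (sound k mk)) mk)
  size-all : length (concatUpTo (suc n) (G (suc n))) ≡ sum1 (suc n) (b (suc n))
  size-all = trans (length-concatUpTo (suc n) (G (suc n))) (sum1-cong (suc n) size)
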